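{- For all positive integers $q$ and $k$ and every $q$-colorful graph $(G,\chi)$, if $(G,\chi)$ contains a $(q,k)$-segregated grid as a colorful minor, then $\mathsf{rtw}(G,\chi)\ge k-1$.
   Context: A $q$-colorful graph is $(G,\chi)$, $G$ finite, $\chi\colon V(G)\to2^{[q]}$; $(J,\chi)$ is restricted if $\bigcup_{v\in V(J)}\chi(v)\subsetneq[q]$. Colorful minor: pairwise vertex-disjoint connected branch sets, adjacent for edges of the minor, each containing every color of its vertex's palette. A $(q,k)$-segregated grid is the $(qk\times qk)$-grid whose first-column vertices $v_1,\dots,v_{qk}$ (in order) are colored so that for some permutation $\pi$ of $[q]$, the vertices $v_j$ with $j\in[(i-1)k+1,ik]$ have palette $\{\pi(i)\}$ for each $i\in[q]$, all other vertices having empty palette. The restrictive treewidth $\mathsf{rtw}(G,\chi)$ is the least $k$ such that some $X\subseteq V(G)$ has torso (i.e. $G[X]$ with the neighborhood in $X$ of each component of $G-X$ turned into a clique) of treewidth at most $k$, and $(J,\chi)$ is restricted for each component $J$ of $G-X$. -}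

module Defs where

open import Data.Nat using (ℕ; zero; suc; _≤_; _*_)
open import Data.Fin using (Fin; toℕ; quotient; _≟_)
open import Data.Fin.Permutation using (Permutation′; _⟨$⟩ʳ_)
open import Data.Bool using (Bool; true; false; _∧_)
open import Data.List using (List; []; _∷_; _++_; [_]; length; filterᵇ; allFin)
open import Data.List.Relation.Unary.Unique.Propositional using (Unique)
open import Data.Product using (Σ; ∃; _×_; _,_)
open import Data.Sum using (_⊎_)
open import Data.Unit using (⊤)
open import Data.Empty using (⊥)
open import Relation.Nullary using (¬_)
open import Relation.Nullary.Decidable using (⌊_⌋)
open import Relation.Binary.PropositionalEquality using (_≡_; _≢_)

record Graph : Set where
  field
    n      : ℕ
    adj    : Fin n → Fin n → Bool
    sym    : ∀ u v → adj u v ≡ adj v u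
    irrefl : ∀ v → adj v v ≡ false
open Graph public

VSet : Graph → Set
VSet G = Fin (n G) → Bool

size : ∀ {m} → (Fin m → Bool) → ℕ
size {m} S = length (filterᵇ S (allFin m))

data WalkIn (G : Graph) (S : VSet G) : Fin (n G) → Fin (n G) → Set where
  here : ∀ {u} → S u ≡ true → WalkIn G S u u
  step : ∀ {u v w} → S u ≡ true → adj G u v ≡ true → WalkIn G S v w → WalkIn G S u w

Connected : (G : Graph) → VSet G → Set
Connected G S = (∃ λ u → S u ≡ true) × (∀ u v → S u ≡ true → S v ≡ true → WalkIn G S u v)

Chain : (G : Graph) → List (Fin (n G)) → Set
Chain G [] = ⊤
Chain G (a ∷ []) = ⊤
Chain G (a ∷ b ∷ l) = (adj G a b ≡ true) × Chain G (b ∷ l)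

IsCycle : (G : Graph) → List (Fin (n G)) → Set
IsCycle G [] = ⊥
IsCycle G (v ∷ rest) = (3 ≤ length (v ∷ rest)) × Unique (v ∷ rest) × Chain G (v ∷ rest ++ [ v ])

Acyclic : Graph → Set
Acyclic G = ¬ (∃ λ vs → IsCycle G vs)

record Tree : Set where
  field
    graph     : Graph
    nonempty  : 1 ≤ n graph
    connected : Connected graph (λ _ → true)
    acyclic   : Acyclic graph
open Tree public

record TreeDecomposition (m : ℕ) (X : Fin m → Bool) (E : Fin m → Fin m → Set) (w : ℕ) : Set₁ where
  field
    T      : Tree
    bag    : Fin (n (graph T)) → Fin m → Bool
    bag⊆X  : ∀ t v → bag t v ≡ true → X v ≡ true
    cover  : ∀ v → X v ≡ true → ∃ λ t → bag t v ≡ true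
    edges  : ∀ u v → E u v → ∃ λ t → (bag t u ≡ true) × (bag t v ≡ true)
    interp : ∀ v → X v ≡ true → Connected (graph T) (λ t → bag t v)
    width  : ∀ t → size (bag t) ≤ suc w

record ColorfulGraph (q : ℕ) : Set where
  field
    G : Graph
    χ : Fin (n G) → Fin q → Bool
open ColorfulGraph public

Restricted : ∀ {q} (Gχ : ColorfulGraph q) → VSet (G Gχ) → Set
Restricted {q} Gχ C = ∃ λ (c : Fin q) → ∀ v → C v ≡ true → χ Gχ v c ≡ false

-- C is (the vertex set of) a component of G - X: a nonempty connected subset of
-- V(G) ∖ X, closed under adjacency in G - X (hence maximal)
Component : (G : Graph) → VSet G → VSet G → Set
Component G X C =
  (∀ v → C v ≡ true → X v ≡ false) ×
  Connected G C ×
  (∀ u v → C u ≡ true → X v ≡ false → adj G u v ≡ true → C v ≡ true)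

NbrOf : (G : Graph) → VSet G → Fin (n G) → Set
NbrOf G C u = ∃ λ w → (C w ≡ true) × (adj G w u ≡ true)

TorsoAdj : (G : Graph) → VSet G → Fin (n G) → Fin (n G) → Set
TorsoAdj G X u v =
  (X u ≡ true) × (X v ≡ true) × (u ≢ v) ×
  ((adj G u v ≡ true) ⊎ (∃ λ C → Component G X C × NbrOf G C u × NbrOf G C v))

RtwAtMost : ∀ {q} → ColorfulGraph q → ℕ → Set₁
RtwAtMost Gχ w =
  Σ (VSet (G Gχ)) λ X →
    TreeDecomposition (n (G Gχ)) X (TorsoAdj (G Gχ) X) w ×
    (∀ C → Component (G Gχ) X C → Restricted Gχ C)

ColorfulMinor : ∀ {q} (VH : Set) (adjH : VH → VH → Set) (ψ : VH → Fin q → Bool)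
                → ColorfulGraph q → Set
ColorfulMinor VH adjH ψ Gχ =
  Σ (VH → VSet (G Gχ)) λ β →
    (∀ h → Connected (G Gχ) (β h)) ×
    (∀ h h' → h ≢ h' → ∀ v → β h v ≡ true → β h' v ≡ false) ×
    (∀ h h' → adjH h h' → ∃ λ u → ∃ λ v →
        (β h u ≡ true) × (β h' v ≡ true) × (adj (G Gχ) u v ≡ true)) ×
    (∀ h c → ψ h c ≡ true → ∃ λ u → (β h u ≡ true) × (χ Gχ u c ≡ true))

-- The (m × m)-grid: vertices (row, column), 0-indexed

AdjNat : ℕ → ℕ → Set
AdjNat a b = (suc a ≡ b) ⊎ (suc b ≡ a)

GridAdj : (m : ℕ) → Fin m × Fin m → Fin m × Fin m → Set
GridAdj m (r , c) (r' , c') = ((r ≡ r') × AdjNat (toℕ c) (toℕ c')) ⊎ ((c ≡ c') × AdjNat (toℕ r) (toℕ r'))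

-- segregated coloring of the (qk × qk)-grid w.r.t. π: the first-column vertex in row r
-- (0-indexed; v_{r+1} in the paper) gets palette {π(⌊r/k⌋)}, all others empty
SegColor : (q k : ℕ) → Permutation′ q → Fin (q * k) × Fin (q * k) → Fin q → Bool
SegColor q k π (r , c) col with toℕ c
... | zero  = ⌊ col ≟ π ⟨$⟩ʳ quotient k r ⌋
... | suc _ = false

HasSegregatedGridMinor : ∀ (q k : ℕ) → ColorfulGraph q → Set
HasSegregatedGridMinor q k Gχ =
  ∃ λ (π : Permutation′ q) →
    ColorfulMinor (Fin (q * k) × Fin (q * k)) (GridAdj (q * k)) (SegColor q k π) Gχ

-- For a residue i modulo k and a column c of the grid, the cross (i, c) is the union of the
-- branch sets of column c and of the q rows congruent to i modulo k. Each cross is connected,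
-- carries every colour (one of its rows runs through each colour block of the first column), and
-- any two crosses meet. As every component of G − X is restricted, a connected set carrying every
-- colour meets X, and then the nodes whose bags meet it span a subtree of the decomposition of the
-- torso: torso edges shortcut each detour of the set through a component of G − X. These subtrees
-- pairwise intersect, so by the Helly property of subtrees a single bag meets every cross. But a bag
-- of at most w + 1 < k vertices misses some row class and some column, hence a whole cross.

{-# OPTIONS --safe #-}
module Submission where

open import Defs hiding (sym)
open import Data.Nat using (ℕ; zero; suc; _+_; _≤_; _<_; _∸_; _*_; z≤n; s≤s)
open import Data.Nat.Properties
  using (<-≤-trans; ≤-<-trans; <⇒≱; ≮⇒≥; ∸-monoˡ-≤; ∸-monoʳ-<; n<1+n; *-mono-≤; *-monoˡ-≤; *-identityˡ)
open import Data.Nat.Induction using (<-wellFounded)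
open import Induction.WellFounded using (Acc; acc)
open import Data.Fin using (Fin; zero; suc; toℕ; fromℕ<; quotient; remainder; combine)
  renaming (_≟_ to _≟ᶠ_)
open import Data.Fin.Properties using (any?; all?; ¬∀⟶∃¬; injective⇒≤; toℕ-fromℕ<; remQuot-combine)
import Data.Fin.Subset as Subset
open Subset using (∣_∣)
open import Data.Fin.Subset.Properties using (∣p∣≤n; p⊂q⇒∣p∣<∣q∣)
open import Data.Fin.Permutation using (Permutation′; _⟨$⟩ʳ_; _⟨$⟩ˡ_; inverseʳ)
open import Data.Bool using (Bool; true; false) renaming (T to IsTrue)
open import Data.Bool.Properties using (not-¬; ¬-not) renaming (_≟_ to _≟ᵇ_)
open import Data.Vec using (tabulate)
open import Data.Vec.Properties using (lookup∘tabulate; lookup⇒[]=; []=⇒lookup)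
open import Data.List using (List; []; _∷_; _++_; [_]; length; lookup; take; filterᵇ; allFin)
open import Data.List.Relation.Unary.All as All using ([]; _∷_)
open import Data.List.Relation.Unary.All.Properties using (¬Any⇒All¬)
open import Data.List.Relation.Unary.AllPairs using ([]; _∷_)
open import Data.List.Relation.Unary.Any using (here; there; index)
open import Data.List.Relation.Unary.Unique.Propositional using (Unique)
open import Data.List.Relation.Unary.Unique.Propositional.Properties using (take⁺)
open import Data.List.Membership.Propositional using (_∈_)
open import Data.List.Membership.Propositional.Properties using (∈-lookup; ∈-∃++; ∈-filter⁺; ∈-allFin)
import Data.List.Membership.Setoid.Properties as SetoidMembership
open import Data.Product using (∃; ∃₂; _×_; _,_; proj₁; proj₂)
open import Data.Product.Properties using (≡-dec)
open import Data.Sum using (_⊎_; inj₁; inj₂; [_,_]′)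
open import Data.Unit using (tt)
open import Data.Empty using (⊥-elim)
open import Function using (_∘_; Injective)
open import Relation.Nullary using (¬_; Dec; yes; no; does; ¬?)
open import Relation.Nullary.Decidable using (_×-dec_; _⊎-dec_; map′; dec-true; decidable-stable; T?)
open import Relation.Unary using (Decidable)
open import Relation.Binary.Construct.Closure.ReflexiveTransitive using (Star; ε; _◅_; _◅◅_; gmap; reverse)
open import Relation.Binary.PropositionalEquality using (_≡_; _≢_; refl; sym; trans; cong; subst; subst₂; setoid)

Searchable : Set → Set₁
Searchable I = ∀ {P : I → Set} → Decidable P → Dec (∃ P)

×-searchable : ∀ {A B : Set} → Searchable A → Searchable B → Searchable (A × B)
×-searchable searchA searchB P? =
  map′ (λ (a , b , p) → (a , b) , p) (λ ((a , b) , p) → a , b , p)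
       (searchA λ a → searchB λ b → P? (a , b))

⟦_⟧ : ∀ {A : Set} {P : A → Set} → Decidable P → A → Bool
⟦ P? ⟧ a = does (P? a)

dec-true⁻ : ∀ {A : Set} (a? : Dec A) → does a? ≡ true → A
dec-true⁻ (yes a) _ = a

_⊆ᵇ_ : ∀ {A : Set} → (A → Bool) → (A → Bool) → Set
U ⊆ᵇ W = ∀ x → U x ≡ true → W x ≡ true

-- The cardinality of U, taken through Data.Fin.Subset so that its monotonicity lemmas apply.
count : ∀ {m} → (Fin m → Bool) → ℕ
count U = ∣ tabulate U ∣

count≤ : ∀ {m} (U : Fin m → Bool) → count U ≤ m
count≤ U = ∣p∣≤n (tabulate U)

∈-tabulate⁺ : ∀ {m} {V : Fin m → Bool} {x} → V x ≡ true → x Subset.∈ tabulate V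
∈-tabulate⁺ {V = V} {x} e = lookup⇒[]= x (tabulate V) (trans (lookup∘tabulate V x) e)

∈-tabulate⁻ : ∀ {m} {V : Fin m → Bool} {x} → x Subset.∈ tabulate V → V x ≡ true
∈-tabulate⁻ {V = V} {x} x∈V = trans (sym (lookup∘tabulate V x)) ([]=⇒lookup x∈V)

count-< : ∀ {m} {U W : Fin m → Bool} → U ⊆ᵇ W → ∀ y → W y ≡ true → U y ≡ false → count U < count W
count-< U⊆W y y∈W y∉U =
  p⊂q⇒∣p∣<∣q∣ ((λ x∈U → ∈-tabulate⁺ (U⊆W _ (∈-tabulate⁻ x∈U))) , y , ∈-tabulate⁺ y∈W , not-¬ y∉U ∘ ∈-tabulate⁻)

few-vertices-miss-a-label : ∀ {N m} (Z : Fin N → Bool) → size Z < m →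
                            (R : Fin N → Fin m → Set) → (∀ v a → Dec (R v a)) → (∀ {v a b} → R v a → R v b → a ≡ b) →
                            ∃ λ a → ∀ v → Z v ≡ true → ¬ R v a
few-vertices-miss-a-label {N} {m} Z |Z|<m R R? functional with all? (λ a → any? λ v → Z v ≟ᵇ true ×-dec R? v a)
... | no ¬all-hit =
  let (a , a-missed) = ¬∀⟶∃¬ m _ (λ a → any? λ v → Z v ≟ᵇ true ×-dec R? v a) ¬all-hit
  in a , λ v v∈Z Rva → a-missed (v , v∈Z , Rva)
... | yes all-hit = ⊥-elim (<⇒≱ |Z|<m (injective⇒≤ position-injective))
  where
    witness∈Z : ∀ a → proj₁ (all-hit a) ∈ filterᵇ Z (allFin N)
    witness∈Z a = ∈-filter⁺ (T? ∘ Z) (∈-allFin _) (subst IsTrue (sym (proj₁ (proj₂ (all-hit a)))) tt)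

    position : Fin m → Fin (size Z)
    position a = index (witness∈Z a)

    position-injective : Injective _≡_ _≡_ position
    position-injective {a} {b} same-position =
      functional (proj₂ (proj₂ (all-hit a)))
                 (subst (λ v → R v b) (sym same-witness) (proj₂ (proj₂ (all-hit b))))
      where
        same-witness = SetoidMembership.index-injective (setoid (Fin N)) (witness∈Z a) (witness∈Z b) same-position

adj-sym : ∀ (G : Graph) {u v} → adj G u v ≡ true → adj G v u ≡ true
adj-sym G {u} {v} e = trans (Graph.sym G v u) e

adj⇒≢ : ∀ (G : Graph) {u v} → adj G u v ≡ true → u ≢ v
adj⇒≢ G {u} e refl = not-¬ e (irrefl G u)

module _ {G : Graph} {S : VSet G} where

  walk-source : ∀ {u v} → WalkIn G S u v → S u ≡ true
  walk-source (here s) = s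
  walk-source (step s _ _) = s

  infixr 5 _++ʷ_
  _++ʷ_ : ∀ {u v x} → WalkIn G S u v → WalkIn G S v x → WalkIn G S u x
  here _ ++ʷ w = w
  step s a w ++ʷ w′ = step s a (w ++ʷ w′)

  reverseʷ : ∀ {u v} → WalkIn G S u v → WalkIn G S v u
  reverseʷ (here s) = here s
  reverseʷ (step s a w) = reverseʷ w ++ʷ step (walk-source w) (adj-sym G a) (here s)

  connected-via-hub : ∀ h → S h ≡ true → (∀ v → S v ≡ true → WalkIn G S v h) → Connected G S
  connected-via-hub h h∈S to-hub = (h , h∈S) , λ u v u∈S v∈S → to-hub u u∈S ++ʷ reverseʷ (to-hub v v∈S)

walk-⊆ : ∀ {G : Graph} {S W : VSet G} → S ⊆ᵇ W → ∀ {u v} → WalkIn G S u v → WalkIn G W u v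
walk-⊆ S⊆W (here s) = here (S⊆W _ s)
walk-⊆ S⊆W (step s a w) = step (S⊆W _ s) a (walk-⊆ S⊆W w)

module Components (G : Graph) (X : VSet G) where

  private
    N = n G

    FrontierEdge : VSet G → Fin N × Fin N → Set
    FrontierEdge R (u , x) = R u ≡ true × X x ≡ false × adj G u x ≡ true × R x ≡ false

    frontier? : ∀ R → Decidable (FrontierEdge R)
    frontier? R (u , x) = R u ≟ᵇ true ×-dec X x ≟ᵇ false ×-dec adj G u x ≟ᵇ true ×-dec R x ≟ᵇ false

    grow : ∀ v (R : VSet G) → Acc _<_ (N ∸ count R) → R v ≡ true → (∀ x → R x ≡ true → X x ≡ false) →
           (∀ x → R x ≡ true → WalkIn G R x v) → ∃ λ C → Component G X C × C v ≡ true
    grow v R (acc smaller) v∈R R∩X=∅ R→v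
      with ×-searchable any? any? (frontier? R)
    ... | no no-frontier = R , (R∩X=∅ , connected-via-hub v v∈R R→v , closed) , v∈R
      where
        closed : ∀ u x → R u ≡ true → X x ≡ false → adj G u x ≡ true → R x ≡ true
        closed u x u∈R x∉X a = ¬-not λ x∉R → no-frontier ((u , x) , u∈R , x∉X , a , x∉R)
    ... | yes ((u , x) , u∈R , x∉X , a , x∉R) =
      grow v R′ (smaller (∸-monoʳ-< R<R′ (count≤ R′))) (R⊆R′ v v∈R) R′∩X=∅ R′→v
      where
        R′ : VSet G
        R′ = ⟦ (λ y → R y ≟ᵇ true ⊎-dec y ≟ᶠ x) ⟧
        R⊆R′ : R ⊆ᵇ R′
        R⊆R′ y y∈R = dec-true (R y ≟ᵇ true ⊎-dec y ≟ᶠ x) (inj₁ y∈R)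
        x∈R′ : R′ x ≡ true
        x∈R′ = dec-true (R x ≟ᵇ true ⊎-dec x ≟ᶠ x) (inj₂ refl)
        R<R′ : count R < count R′
        R<R′ = count-< R⊆R′ x x∈R′ x∉R
        R′∩X=∅ : ∀ y → R′ y ≡ true → X y ≡ false
        R′∩X=∅ y y∈R′ with dec-true⁻ (R y ≟ᵇ true ⊎-dec y ≟ᶠ x) y∈R′
        ... | inj₁ y∈R = R∩X=∅ y y∈R
        ... | inj₂ refl = x∉X
        R′→v : ∀ y → R′ y ≡ true → WalkIn G R′ y v
        R′→v y y∈R′ with dec-true⁻ (R y ≟ᵇ true ⊎-dec y ≟ᶠ x) y∈R′
        ... | inj₁ y∈R = walk-⊆ R⊆R′ (R→v y y∈R)
        ... | inj₂ refl = step x∈R′ (adj-sym G a) (walk-⊆ R⊆R′ (R→v u u∈R))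

  component-containing : ∀ v → X v ≡ false → ∃ λ C → Component G X C × C v ≡ true
  component-containing v v∉X = grow v R (<-wellFounded _) v∈R R∩X=∅ R→v
    where
      R : VSet G
      R = ⟦ (_≟ᶠ v) ⟧
      v∈R : R v ≡ true
      v∈R = dec-true (v ≟ᶠ v) refl
      R∩X=∅ : ∀ x → R x ≡ true → X x ≡ false
      R∩X=∅ x x∈R with refl ← dec-true⁻ (x ≟ᶠ v) x∈R = v∉X
      R→v : ∀ x → R x ≡ true → WalkIn G R x v
      R→v x x∈R with refl ← dec-true⁻ (x ≟ᶠ v) x∈R = here v∈R

  walk-stays-in-component : ∀ {C S} → Component G X C → (∀ x → S x ≡ true → X x ≡ false) →
                            ∀ {u v} → WalkIn G S u v → C u ≡ true → C v ≡ true
  walk-stays-in-component comp S∩X=∅ (here _) u∈C = u∈C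
  walk-stays-in-component comp S∩X=∅ (step _ a w) u∈C =
    walk-stays-in-component comp S∩X=∅ w (proj₂ (proj₂ comp) _ _ u∈C (S∩X=∅ _ (walk-source w)) a)

  walk-exits-component : ∀ {C S} → Component G X C → ∀ {u x} → WalkIn G S u x → C u ≡ true → X x ≡ true →
                         ∃ λ a → X a ≡ true × S a ≡ true × NbrOf G C a
  walk-exits-component comp (here _) u∈C x∈X = ⊥-elim (not-¬ x∈X (proj₁ comp _ u∈C))
  walk-exits-component comp {u} (step {v = z} _ a w) u∈C x∈X with X z in z∈?X
  ... | true = z , z∈?X , walk-source w , u , u∈C , a
  ... | false = walk-exits-component comp w (proj₂ (proj₂ comp) u z u∈C z∈?X a) x∈X

take-through : ∀ {A : Set} (xs : List A) a ys → take (suc (length xs)) (xs ++ a ∷ ys) ≡ xs ++ [ a ]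
take-through [] a ys = refl
take-through (x ∷ xs) a ys = cong (x ∷_) (take-through xs a ys)

Unique⇒lookup-injective : ∀ {A : Set} {xs : List A} → Unique xs → Injective _≡_ _≡_ (lookup xs)
Unique⇒lookup-injective (_ ∷ _) {zero} {zero} _ = refl
Unique⇒lookup-injective (x∉xs ∷ _) {zero} {suc j} e = ⊥-elim (All.lookup x∉xs (∈-lookup j) e)
Unique⇒lookup-injective (x∉xs ∷ _) {suc i} {zero} e = ⊥-elim (All.lookup x∉xs (∈-lookup i) (sym e))
Unique⇒lookup-injective (_ ∷ xs-unique) {suc i} {suc j} e = cong suc (Unique⇒lookup-injective xs-unique e)

Unique⇒length≤ : ∀ {m} {xs : List (Fin m)} → Unique xs → length xs ≤ m
Unique⇒length≤ xs-unique = injective⇒≤ (Unique⇒lookup-injective xs-unique)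

module _ {G : Graph} where

  Chain-take : ∀ k xs → Chain G xs → Chain G (take k xs)
  Chain-take zero xs _ = tt
  Chain-take (suc k) [] _ = tt
  Chain-take (suc zero) (x ∷ xs) _ = tt
  Chain-take (suc (suc k)) (x ∷ []) _ = tt
  Chain-take (suc (suc k)) (x ∷ y ∷ xs) (a , c) = a , Chain-take (suc k) (y ∷ xs) c

  Chain-∷ʳ : ∀ xs a b → Chain G (xs ++ [ a ]) → adj G a b ≡ true → Chain G ((xs ++ [ a ]) ++ [ b ])
  Chain-∷ʳ [] a b _ e = e , tt
  Chain-∷ʳ (x ∷ []) a b (e′ , _) e = e′ , e , tt
  Chain-∷ʳ (x ∷ y ∷ xs) a b (e′ , c) e = e′ , Chain-∷ʳ (y ∷ xs) a b c e

module Subtrees (T : Graph) (acyclic : Acyclic T) where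
  open import Data.List.Membership.DecPropositional (_≟ᶠ_ {n T}) using (_∈?_)

  private
    V = Fin (n T)

  path-head-has-no-chord : ∀ {x x₂ rest y} → Unique (x ∷ x₂ ∷ rest) → Chain T (x ∷ x₂ ∷ rest) →
                           y ∈ rest → adj T x y ≢ true
  path-head-has-no-chord {x} {x₂} {y = y} path-unique path-chain y∈rest x~y
    with pre , post , refl ← ∈-∃++ y∈rest =
    acyclic (x ∷ x₂ ∷ pre ++ [ y ] , s≤s (s≤s (length-∷ʳ-positive pre)) ,
             subst Unique cut (take⁺ (3 + length pre) path-unique) ,
             Chain-∷ʳ (x ∷ x₂ ∷ pre) y x (subst (Chain T) cut (Chain-take (3 + length pre) _ path-chain))
                      (adj-sym T x~y))
    where
      cut : take (3 + length pre) (x ∷ x₂ ∷ pre ++ y ∷ post) ≡ x ∷ x₂ ∷ pre ++ [ y ]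
      cut = take-through (x ∷ x₂ ∷ pre) y post
      length-∷ʳ-positive : ∀ (xs : List V) → 1 ≤ length (xs ++ [ y ])
      length-∷ʳ-positive [] = s≤s z≤n
      length-∷ʳ-positive (_ ∷ _) = s≤s z≤n

  record Leaf (U : V → Bool) : Set where
    field
      ℓ p : V
      ℓ∈U : U ℓ ≡ true
      p∈U : U p ≡ true
      ℓ~p : adj T ℓ p ≡ true
      unique-neighbour : ∀ y → U y ≡ true → adj T ℓ y ≡ true → y ≡ p

  maximal-path-ends-in-leaf : ∀ U x x₂ rest → Unique (x ∷ x₂ ∷ rest) → Chain T (x ∷ x₂ ∷ rest) →
                              U x ≡ true → U x₂ ≡ true →
                              (∀ y → U y ≡ true → adj T x y ≡ true → y ∈ x ∷ x₂ ∷ rest) → Leaf U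
  maximal-path-ends-in-leaf U x x₂ rest path-unique path-chain x∈U x₂∈U maximal = record
    { ℓ = x ; p = x₂ ; ℓ∈U = x∈U ; p∈U = x₂∈U ; ℓ~p = proj₁ path-chain ; unique-neighbour = only-x₂ }
    where
      only-x₂ : ∀ y → U y ≡ true → adj T x y ≡ true → y ≡ x₂
      only-x₂ y y∈U x~y with maximal y y∈U x~y
      ... | here refl = ⊥-elim (adj⇒≢ T x~y refl)
      ... | there (here y≡x₂) = y≡x₂
      ... | there (there y∈rest) = ⊥-elim (path-head-has-no-chord path-unique path-chain y∈rest x~y)

  extend-to-leaf : ∀ U x x₂ rest → Acc _<_ (n T ∸ length (x ∷ x₂ ∷ rest)) →
                   Unique (x ∷ x₂ ∷ rest) → Chain T (x ∷ x₂ ∷ rest) → U x ≡ true → U x₂ ≡ true → Leaf U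
  extend-to-leaf U x x₂ rest (acc longer) path-unique path-chain x∈U x₂∈U
    with any? (λ y → U y ≟ᵇ true ×-dec adj T x y ≟ᵇ true ×-dec ¬? (y ∈? x ∷ x₂ ∷ rest))
  ... | yes (y , y∈U , x~y , y∉path) =
    extend-to-leaf U y x (x₂ ∷ rest) (longer (∸-monoʳ-< (n<1+n _) (Unique⇒length≤ longer-unique)))
                   longer-unique (adj-sym T x~y , path-chain) y∈U x∈U
    where
      longer-unique : Unique (y ∷ x ∷ x₂ ∷ rest)
      longer-unique = ¬Any⇒All¬ _ y∉path ∷ path-unique
  ... | no no-extension = maximal-path-ends-in-leaf U x x₂ rest path-unique path-chain x∈U x₂∈U maximal
    where
      maximal : ∀ y → U y ≡ true → adj T x y ≡ true → y ∈ x ∷ x₂ ∷ rest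
      maximal y y∈U x~y = decidable-stable (y ∈? _) λ y∉path → no-extension (y , y∈U , x~y , y∉path)

  leaf-or-singleton : ∀ U → Connected T U → (∃ λ u → ∀ v → U v ≡ true → v ≡ u) ⊎ Leaf U
  leaf-or-singleton U ((u , u∈U) , walks) with any? (λ v → U v ≟ᵇ true ×-dec ¬? (v ≟ᶠ u))
  ... | no only-u = inj₁ (u , λ v v∈U → decidable-stable (v ≟ᶠ u) λ v≢u → only-u (v , v∈U , v≢u))
  ... | yes (v , v∈U , v≢u) with walks u v u∈U v∈U
  ...   | here _ = ⊥-elim (v≢u refl)
  ...   | step {v = u₁} _ u~u₁ w =
    inj₂ (extend-to-leaf U u₁ u [] (<-wellFounded _) ((adj⇒≢ T (adj-sym T u~u₁) ∷ []) ∷ [] ∷ [])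
                         (adj-sym T u~u₁ , tt) (walk-source w) u∈U)

  module LeafDeletion {U : V → Bool} (L : Leaf U) where
    open Leaf L

    _-ℓ : (V → Bool) → V → Bool
    W -ℓ = ⟦ (λ v → W v ≟ᵇ true ×-dec ¬? (v ≟ᶠ ℓ)) ⟧

    ∈-ℓ⁺ : ∀ W {v} → W v ≡ true → v ≢ ℓ → (W -ℓ) v ≡ true
    ∈-ℓ⁺ W {v} v∈W v≢ℓ = dec-true (W v ≟ᵇ true ×-dec ¬? (v ≟ᶠ ℓ)) (v∈W , v≢ℓ)

    ∈-ℓ⁻ : ∀ W {v} → (W -ℓ) v ≡ true → W v ≡ true × v ≢ ℓ
    ∈-ℓ⁻ W {v} = dec-true⁻ (W v ≟ᵇ true ×-dec ¬? (v ≟ᶠ ℓ))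

    ℓ∉-ℓ : ∀ W → (W -ℓ) ℓ ≡ false
    ℓ∉-ℓ W = ¬-not λ ℓ∈ → proj₂ (∈-ℓ⁻ W ℓ∈) refl

    p≢ℓ : p ≢ ℓ
    p≢ℓ = adj⇒≢ T (adj-sym T ℓ~p)

    ρ : V → V
    ρ v with v ≟ᶠ ℓ
    ... | yes _ = p
    ... | no _ = v

    ρ-∈ : ∀ W {v} → (W ℓ ≡ true → W p ≡ true) → W v ≡ true → (W -ℓ) (ρ v) ≡ true
    ρ-∈ W {v} ℓ⇒p v∈W with v ≟ᶠ ℓ
    ... | yes refl = ∈-ℓ⁺ W (ℓ⇒p v∈W) p≢ℓ
    ... | no v≢ℓ = ∈-ℓ⁺ W v∈W v≢ℓ

    ρ-fixes : ∀ {v} → v ≢ ℓ → ρ v ≡ v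
    ρ-fixes {v} v≢ℓ with v ≟ᶠ ℓ
    ... | yes v≡ℓ = ⊥-elim (v≢ℓ v≡ℓ)
    ... | no _ = refl

    ρ-adj : ∀ {u z} → U u ≡ true → U z ≡ true → adj T u z ≡ true → ρ u ≡ ρ z ⊎ (u ≢ ℓ × z ≢ ℓ)
    ρ-adj {u} {z} u∈U z∈U u~z with u ≟ᶠ ℓ | z ≟ᶠ ℓ
    ... | yes refl | yes refl = ⊥-elim (adj⇒≢ T u~z refl)
    ... | yes refl | no _ = inj₁ (sym (unique-neighbour z z∈U u~z))
    ... | no _ | yes refl = inj₁ (unique-neighbour u u∈U (adj-sym T u~z))
    ... | no u≢ℓ | no z≢ℓ = inj₂ (u≢ℓ , z≢ℓ)

    retract-walk : ∀ {W} → W ⊆ᵇ U → (W ℓ ≡ true → W p ≡ true) →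
                   ∀ {u v} → WalkIn T W u v → WalkIn T (W -ℓ) (ρ u) (ρ v)
    retract-walk {W} W⊆U ℓ⇒p (here v∈W) = here (ρ-∈ W ℓ⇒p v∈W)
    retract-walk {W} W⊆U ℓ⇒p (step {u} {z} u∈W u~z w)
      with ρ-adj (W⊆U u u∈W) (W⊆U z (walk-source w)) u~z
    ... | inj₁ ρu≡ρz rewrite ρu≡ρz = retract-walk W⊆U ℓ⇒p w
    ... | inj₂ (u≢ℓ , z≢ℓ) rewrite ρ-fixes u≢ℓ =
      step (∈-ℓ⁺ W u∈W u≢ℓ) (subst (λ y → adj T u y ≡ true) (sym (ρ-fixes z≢ℓ)) u~z) (retract-walk W⊆U ℓ⇒p w)

    deletion-connected : ∀ {W} → W ⊆ᵇ U → (W ℓ ≡ true → W p ≡ true) → Connected T W → Connected T (W -ℓ)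
    deletion-connected {W} W⊆U ℓ⇒p ((x , x∈W) , walks) = (ρ x , ρ-∈ W ℓ⇒p x∈W) , walks-ℓ
      where
        walks-ℓ : ∀ u v → (W -ℓ) u ≡ true → (W -ℓ) v ≡ true → WalkIn T (W -ℓ) u v
        walks-ℓ u v u∈ v∈ with (u∈W , u≢ℓ) ← ∈-ℓ⁻ W u∈ | (v∈W , v≢ℓ) ← ∈-ℓ⁻ W v∈ =
          subst₂ (WalkIn T (W -ℓ)) (ρ-fixes u≢ℓ) (ρ-fixes v≢ℓ) (retract-walk W⊆U ℓ⇒p (walks u v u∈W v∈W))

    trapped-at-leaf : ∀ {W} → W ⊆ᵇ U → Connected T W → W ℓ ≡ true → W p ≡ false → ∀ x → W x ≡ true → x ≡ ℓ
    trapped-at-leaf W⊆U (_ , walks) ℓ∈W p∉W x x∈W with walks ℓ x ℓ∈W x∈W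
    ... | here _ = refl
    ... | step {v = z} _ ℓ~z w with refl ← unique-neighbour z (W⊆U z (walk-source w)) ℓ~z =
      ⊥-elim (not-¬ (walk-source w) p∉W)

  -- Delete a leaf ℓ of U, with neighbour p. A member containing ℓ but not p is {ℓ}, so ℓ is common
  -- to all members; otherwise deleting ℓ from every member keeps them connected and pairwise meeting.
  helly-within : ∀ {I : Set} → Searchable I → ∀ (U : V → Bool) → Acc _<_ (count U) → Connected T U →
                 (F : I → V → Bool) → (∀ i → F i ⊆ᵇ U) → (∀ i → Connected T (F i)) →
                 (∀ i j → ∃ λ v → F i v ≡ true × F j v ≡ true) → ∃ λ t → ∀ i → F i t ≡ true
  helly-within search U (acc smaller) U-connected F F⊆U F-connected F-meet
    with leaf-or-singleton U U-connected
  ... | inj₁ (u , U⊆u) = u , λ i →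
    let (x , x∈F) = proj₁ (F-connected i) in subst (λ y → F i y ≡ true) (U⊆u x (F⊆U i x x∈F)) x∈F
  ... | inj₂ L with search (λ i → F i (Leaf.ℓ L) ≟ᵇ true ×-dec F i (Leaf.p L) ≟ᵇ false)
  ...   | yes (i , ℓ∈F , p∉F) = Leaf.ℓ L , λ j →
    let (x , x∈Fi , x∈Fj) = F-meet i j
    in subst (λ y → F j y ≡ true) (LeafDeletion.trapped-at-leaf L (F⊆U i) (F-connected i) ℓ∈F p∉F x x∈Fi) x∈Fj
  ...   | no none = let (t , t∈F-ℓ) = common in t , λ i → proj₁ (∈-ℓ⁻ (F i) (t∈F-ℓ i))
    where
      open Leaf L
      open LeafDeletion L

      ℓ⇒p : ∀ i → F i ℓ ≡ true → F i p ≡ true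
      ℓ⇒p i ℓ∈F = decidable-stable (F i p ≟ᵇ true) λ p∉F → none (i , ℓ∈F , ¬-not p∉F)

      meet-ℓ : ∀ i j → ∃ λ v → (F i -ℓ) v ≡ true × (F j -ℓ) v ≡ true
      meet-ℓ i j with F-meet i j
      ... | v , v∈Fi , v∈Fj with v ≟ᶠ ℓ
      ...   | yes refl = p , ∈-ℓ⁺ (F i) (ℓ⇒p i v∈Fi) p≢ℓ , ∈-ℓ⁺ (F j) (ℓ⇒p j v∈Fj) p≢ℓ
      ...   | no v≢ℓ = v , ∈-ℓ⁺ (F i) v∈Fi v≢ℓ , ∈-ℓ⁺ (F j) v∈Fj v≢ℓ

      U-ℓ⊆U : (U -ℓ) ⊆ᵇ U
      U-ℓ⊆U v v∈ = proj₁ (∈-ℓ⁻ U v∈)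

      F-ℓ⊆U-ℓ : ∀ i → (F i -ℓ) ⊆ᵇ (U -ℓ)
      F-ℓ⊆U-ℓ i v v∈ = let (v∈F , v≢ℓ) = ∈-ℓ⁻ (F i) v∈ in ∈-ℓ⁺ U (F⊆U i v v∈F) v≢ℓ

      common : ∃ λ t → ∀ i → (F i -ℓ) t ≡ true
      common = helly-within search (U -ℓ) (smaller (count-< U-ℓ⊆U ℓ ℓ∈U (ℓ∉-ℓ U)))
                 (deletion-connected (λ _ v∈U → v∈U) (λ _ → p∈U) U-connected)
                 (λ i → F i -ℓ) F-ℓ⊆U-ℓ (λ i → deletion-connected (F⊆U i) (ℓ⇒p i) (F-connected i)) meet-ℓ

helly : ∀ (T : Tree) {I : Set} → Searchable I → (F : I → Fin (n (graph T)) → Bool) →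
        (∀ i → Connected (graph T) (F i)) → (∀ i j → ∃ λ v → F i v ≡ true × F j v ≡ true) →
        ∃ λ t → ∀ i → F i t ≡ true
helly T search F F-connected F-meet =
  Subtrees.helly-within (graph T) (acyclic T) search (λ _ → true) (<-wellFounded _) (connected T)
                        F (λ _ _ _ → refl) F-connected F-meet

module TorsoDecomposition {G : Graph} {X : VSet G} {w : ℕ}
                          (D : TreeDecomposition (n G) X (TorsoAdj G X) w) where
  open TreeDecomposition D
  open Components G X

  private
    Node = Fin (n (graph T))

  nodes-meeting : VSet G → Node → Bool
  nodes-meeting S = ⟦ (λ t → any? λ v → bag t v ≟ᵇ true ×-dec S v ≟ᵇ true) ⟧

  nodes-meeting⁺ : ∀ S {t v} → bag t v ≡ true → S v ≡ true → nodes-meeting S t ≡ true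
  nodes-meeting⁺ S {t} v∈t v∈S = dec-true (any? λ v → bag t v ≟ᵇ true ×-dec S v ≟ᵇ true) (_ , v∈t , v∈S)

  nodes-meeting⁻ : ∀ S {t} → nodes-meeting S t ≡ true → ∃ λ v → bag t v ≡ true × S v ≡ true
  nodes-meeting⁻ S {t} = dec-true⁻ (any? λ v → bag t v ≟ᵇ true ×-dec S v ≟ᵇ true)

  SharedBag : Fin (n G) → Fin (n G) → Set
  SharedBag a b = ∃ λ t → bag t a ≡ true × bag t b ≡ true

  shared-bag-of-adjacent : ∀ {a b} → X a ≡ true → X b ≡ true → adj G a b ≡ true → SharedBag a b
  shared-bag-of-adjacent a∈X b∈X a~b = edges _ _ (a∈X , b∈X , adj⇒≢ G a~b , inj₁ a~b)

  shared-bag-of-attachments : ∀ {C a b} → Component G X C → X a ≡ true → X b ≡ true →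
                              NbrOf G C a → NbrOf G C b → SharedBag a b
  shared-bag-of-attachments {a = a} {b} comp a∈X b∈X a~C b~C with a ≟ᶠ b
  ... | yes refl = let (t , a∈t) = cover a a∈X in t , a∈t , a∈t
  ... | no a≢b = edges a b (a∈X , b∈X , a≢b , inj₂ (_ , comp , a~C , b~C))

  -- If a sees z, then a and any vertex of X adjacent to z are equal or adjacent in the torso.
  Sees : Fin (n G) → Fin (n G) → Set
  Sees a z = a ≡ z ⊎ ∃ λ C → Component G X C × C z ≡ true × NbrOf G C a

  sees-step : ∀ {a z z′} → Sees a z → X z′ ≡ false → adj G z z′ ≡ true → Sees a z′
  sees-step (inj₁ refl) z′∉X z~z′ with C , comp , z′∈C ← component-containing _ z′∉X =
    inj₂ (C , comp , z′∈C , _ , z′∈C , adj-sym G z~z′)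
  sees-step (inj₂ (C , comp , z∈C , a~C)) z′∉X z~z′ =
    inj₂ (C , comp , proj₂ (proj₂ comp) _ _ z∈C z′∉X z~z′ , a~C)

  sees-shared-bag : ∀ {a z b} → Sees a z → X a ≡ true → X b ≡ true → adj G z b ≡ true → SharedBag a b
  sees-shared-bag (inj₁ refl) a∈X b∈X a~b = shared-bag-of-adjacent a∈X b∈X a~b
  sees-shared-bag (inj₂ (C , comp , z∈C , a~C)) a∈X b∈X z~b =
    shared-bag-of-attachments comp a∈X b∈X a~C (_ , z∈C , z~b)

  bags-containing-walk : ∀ S {a} → X a ≡ true → S a ≡ true → ∀ {t t′} → bag t a ≡ true → bag t′ a ≡ true →
                         WalkIn (graph T) (nodes-meeting S) t t′
  bags-containing-walk S {a} a∈X a∈S a∈t a∈t′ =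
    walk-⊆ (λ s a∈s → nodes-meeting⁺ S a∈s a∈S) (proj₂ (interp a a∈X) _ _ a∈t a∈t′)

  nodes-meeting-walk : ∀ S {z b} → WalkIn G S z b → X b ≡ true → ∀ {a} → X a ≡ true → S a ≡ true → Sees a z →
                       ∀ {t t′} → bag t a ≡ true → bag t′ b ≡ true → WalkIn (graph T) (nodes-meeting S) t t′
  nodes-meeting-walk S (here _) b∈X a∈X a∈S (inj₁ refl) a∈t b∈t′ = bags-containing-walk S a∈X a∈S a∈t b∈t′
  nodes-meeting-walk S (here _) b∈X a∈X a∈S (inj₂ (C , comp , b∈C , _)) _ _ =
    ⊥-elim (not-¬ b∈X (proj₁ comp _ b∈C))
  nodes-meeting-walk S (step {v = z′} _ z~z′ w) b∈X a∈X a∈S sees a∈t b∈t′ with X z′ in z′∈?X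
  ... | true with s , a∈s , z′∈s ← sees-shared-bag sees a∈X z′∈?X z~z′ =
    bags-containing-walk S a∈X a∈S a∈t a∈s ++ʷ
    nodes-meeting-walk S w b∈X z′∈?X (walk-source w) (inj₁ refl) z′∈s b∈t′
  ... | false = nodes-meeting-walk S w b∈X a∈X a∈S (sees-step sees z′∈?X z~z′) a∈t b∈t′

  nodes-meeting-connected : ∀ {S} → Connected G S → (∃ λ x → S x ≡ true × X x ≡ true) →
                            Connected (graph T) (nodes-meeting S)
  nodes-meeting-connected {S} (_ , walks) (x , x∈S , x∈X) with t₀ , x∈t₀ ← cover x x∈X =
    (t₀ , nodes-meeting⁺ S x∈t₀ x∈S) , walks-T
    where
      walks-T : ∀ t t′ → nodes-meeting S t ≡ true → nodes-meeting S t′ ≡ true → WalkIn (graph T) (nodes-meeting S) t t′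
      walks-T t t′ t∈ t′∈ with v , v∈t , v∈S ← nodes-meeting⁻ S t∈ | v′ , v′∈t′ , v′∈S ← nodes-meeting⁻ S t′∈ =
        nodes-meeting-walk S (walks v v′ v∈S v′∈S) (bag⊆X _ _ v′∈t′) (bag⊆X _ _ v∈t) v∈S (inj₁ refl) v∈t v′∈t′

  nodes-meeting-intersect : ∀ {S S′} → Connected G S → Connected G S′ →
                            (∃ λ x → S x ≡ true × X x ≡ true) → (∃ λ x → S′ x ≡ true × X x ≡ true) →
                            ∀ u → S u ≡ true → S′ u ≡ true →
                            ∃ λ t → nodes-meeting S t ≡ true × nodes-meeting S′ t ≡ true
  nodes-meeting-intersect {S} {S′} (_ , walks) (_ , walks′) (x , x∈S , x∈X) (x′ , x′∈S′ , x′∈X) u u∈S u∈S′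
    with X u in u∈?X
  ... | true with t , u∈t ← cover u u∈?X = t , nodes-meeting⁺ S u∈t u∈S , nodes-meeting⁺ S′ u∈t u∈S′
  ... | false =
    let (C , comp , u∈C) = component-containing u u∈?X
        (a , a∈X , a∈S , a~C) = walk-exits-component comp (walks u x u∈S x∈S) u∈C x∈X
        (b , b∈X , b∈S′ , b~C) = walk-exits-component comp (walks′ u x′ u∈S′ x′∈S′) u∈C x′∈X
        (t , a∈t , b∈t) = shared-bag-of-attachments comp a∈X b∈X a~C b~C
    in t , nodes-meeting⁺ S a∈t a∈S , nodes-meeting⁺ S′ b∈t b∈S′

module _ {q} (Gχ : ColorfulGraph q) {X : VSet (G Gχ)} where
  open Components (G Gχ) X

  colorful-set-meets : (∀ C → Component (G Gχ) X C → Restricted Gχ C) →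
                       ∀ {S} → Connected (G Gχ) S → (∀ c → ∃ λ v → S v ≡ true × χ Gχ v c ≡ true) →
                       ∃ λ x → S x ≡ true × X x ≡ true
  colorful-set-meets restricted {S} ((u , u∈S) , walks) colorful
    with any? (λ x → S x ≟ᵇ true ×-dec X x ≟ᵇ true)
  ... | yes meet = meet
  ... | no S∩X=∅ =
    let (C , comp , u∈C) = component-containing u (S⊆V∖X u u∈S)
        (c , C-misses-c) = restricted C comp
        (v , v∈S , v-has-c) = colorful c
    in ⊥-elim (not-¬ v-has-c (C-misses-c v (walk-stays-in-component comp S⊆V∖X (walks u v u∈S v∈S) u∈C)))
    where
      S⊆V∖X : ∀ x → S x ≡ true → X x ≡ false
      S⊆V∖X x x∈S = ¬-not λ x∈X → S∩X=∅ (x , x∈S , x∈X)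

Consecutive : ∀ {m} → Fin m → Fin m → Set
Consecutive a b = AdjNat (toℕ a) (toℕ b)

consecutive-sym : ∀ {m} {a b : Fin m} → Consecutive a b → Consecutive b a
consecutive-sym (inj₁ e) = inj₂ e
consecutive-sym (inj₂ e) = inj₁ e

consecutive-path-from-zero : ∀ {m} (a : Fin (suc m)) → Star Consecutive zero a
consecutive-path-from-zero zero = ε
consecutive-path-from-zero {suc m} (suc a) = inj₁ refl ◅ gmap suc shift (consecutive-path-from-zero a)
  where
    shift : ∀ {x y : Fin (suc m)} → Consecutive x y → Consecutive (suc x) (suc y)
    shift (inj₁ e) = inj₁ (cong suc e)
    shift (inj₂ e) = inj₂ (cong suc e)

consecutive-path : ∀ {m} (a b : Fin m) → Star Consecutive a b
consecutive-path {suc m} a b = reverse consecutive-sym (consecutive-path-from-zero a) ◅◅ consecutive-path-from-zero b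

module BranchSets {q} {V : Set} (search : Searchable V) {adjH : V → V → Set} {ψ : V → Fin q → Bool}
                  {Gχ : ColorfulGraph q} (minor : ColorfulMinor V adjH ψ Gχ) where

  β : V → VSet (G Gχ)
  β = proj₁ minor

  β-connected : ∀ h → Connected (G Gχ) (β h)
  β-connected = proj₁ (proj₂ minor)

  β-inhabited : ∀ h → ∃ λ v → β h v ≡ true
  β-inhabited h = proj₁ (β-connected h)

  β-unique : (∀ (h h′ : V) → Dec (h ≡ h′)) → ∀ {h h′ v} → β h v ≡ true → β h′ v ≡ true → h ≡ h′
  β-unique _≟_ {h} {h′} {v} v∈h v∈h′ =
    decidable-stable (h ≟ h′) λ h≢h′ → not-¬ v∈h′ (proj₁ (proj₂ (proj₂ minor)) h h′ h≢h′ v v∈h)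

  β-adjacent : ∀ {h h′} → adjH h h′ → ∃₂ λ u v → β h u ≡ true × β h′ v ≡ true × adj (G Gχ) u v ≡ true
  β-adjacent = proj₁ (proj₂ (proj₂ (proj₂ minor))) _ _

  β-colors : ∀ h c → ψ h c ≡ true → ∃ λ u → β h u ≡ true × χ Gχ u c ≡ true
  β-colors = proj₂ (proj₂ (proj₂ (proj₂ minor)))

  ⋃ : ∀ {P : V → Set} → Decidable P → VSet (G Gχ)
  ⋃ P? = ⟦ (λ v → search λ h → P? h ×-dec β h v ≟ᵇ true) ⟧

  ⋃⁺ : ∀ {P : V → Set} (P? : Decidable P) {h v} → P h → β h v ≡ true → ⋃ P? v ≡ true
  ⋃⁺ P? {v = v} Ph v∈h = dec-true (search λ h → P? h ×-dec β h v ≟ᵇ true) (_ , Ph , v∈h)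

  ⋃⁻ : ∀ {P : V → Set} (P? : Decidable P) {v} → ⋃ P? v ≡ true → ∃ λ h → P h × β h v ≡ true
  ⋃⁻ P? {v} = dec-true⁻ (search λ h → P? h ×-dec β h v ≟ᵇ true)

  Labelled : ∀ {L : Set} → (V → L) → Fin (n (G Gχ)) → L → Set
  Labelled f v a = ∃ λ h → β h v ≡ true × f h ≡ a

  labelled? : ∀ {m} (f : V → Fin m) → ∀ v a → Dec (Labelled f v a)
  labelled? f v a = search (λ h → β h v ≟ᵇ true ×-dec f h ≟ᶠ a)

  labelled-functional : (∀ (h h′ : V) → Dec (h ≡ h′)) → ∀ {L : Set} (f : V → L) {v a b} →
                        Labelled f v a → Labelled f v b → a ≡ b
  labelled-functional _≟_ f (h , v∈h , refl) (h′ , v∈h′ , refl) = cong f (β-unique _≟_ v∈h v∈h′)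

  ⋃-walk : ∀ {P : V → Set} (P? : Decidable P) {h h′} → P h → Star (λ g g′ → adjH g g′ × P g′) h h′ →
           ∀ {x y} → β h x ≡ true → β h′ y ≡ true → WalkIn (G Gχ) (⋃ P?) x y
  ⋃-walk P? {h} Ph ε x∈h y∈h = walk-⊆ (λ _ → ⋃⁺ P? Ph) (proj₂ (β-connected h) _ _ x∈h y∈h)
  ⋃-walk P? {h} Ph ((g~g′ , Pg′) ◅ path) x∈h y∈h′
    with u , v , u∈h , v∈g′ , u~v ← β-adjacent g~g′ =
    walk-⊆ (λ _ → ⋃⁺ P? Ph) (proj₂ (β-connected h) _ _ x∈h u∈h) ++ʷ
    step (⋃⁺ P? Ph u∈h) u~v (⋃-walk P? Pg′ path v∈g′ y∈h′)

segcolor-first-column : ∀ q k (π : Permutation′ q) r c col → toℕ c ≡ 0 → col ≡ π ⟨$⟩ʳ quotient k r →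
                        SegColor q k π (r , c) col ≡ true
segcolor-first-column q k π r c col c≡0 col≡π⟨r/k⟩ with toℕ c | c≡0
... | .0 | refl with col ≟ᶠ π ⟨$⟩ʳ quotient k r
...   | yes _ = refl
...   | no col≢π⟨r/k⟩ = ⊥-elim (col≢π⟨r/k⟩ col≡π⟨r/k⟩)

module SegregatedGrid {q k : ℕ} (q≥1 : 1 ≤ q) (k≥1 : 1 ≤ k) {Gχ : ColorfulGraph q} (π : Permutation′ q)
  (minor : ColorfulMinor (Fin (q * k) × Fin (q * k)) (GridAdj (q * k)) (SegColor q k π) Gχ) where

  private
    M = q * k
    Cell = Fin M × Fin M

  open BranchSets (×-searchable any? any?) minor

  -- Cells are (row, column); row r has class remainder k r = r mod k and lies in colour block
  -- quotient k r, so combine j i is the row of class i in block j.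
  InCross : Fin k → Fin M → Cell → Set
  InCross i c (r , c′) = c′ ≡ c ⊎ remainder {q} k r ≡ i

  inCross? : ∀ i c → Decidable (InCross i c)
  inCross? i c (r , c′) = c′ ≟ᶠ c ⊎-dec remainder {q} k r ≟ᶠ i

  cross : Fin k → Fin M → VSet (G Gχ)
  cross i c = ⋃ (inCross? i c)

  remainder-combine : ∀ j i → remainder {q} k (combine j i) ≡ i
  remainder-combine j i = cong proj₂ (remQuot-combine {q} {k} j i)

  quotient-combine : ∀ j i → quotient {q} k (combine j i) ≡ j
  quotient-combine j i = cong proj₁ (remQuot-combine {q} {k} j i)

  hub : Fin k → Fin M → Cell
  hub i c = combine (fromℕ< q≥1) i , c

  CrossStep : Fin k → Fin M → Cell → Cell → Set
  CrossStep i c g g′ = GridAdj M g g′ × InCross i c g′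

  column-path : ∀ {i c} r r′ → Star (CrossStep i c) (r , c) (r′ , c)
  column-path r r′ = gmap (_, _) (λ r~r′ → inj₂ (refl , r~r′) , inj₁ refl) (consecutive-path r r′)

  row-path : ∀ {i c r} → remainder {q} k r ≡ i → ∀ c₁ c₂ → Star (CrossStep i c) (r , c₁) (r , c₂)
  row-path r≡i c₁ c₂ = gmap (_ ,_) (λ c₁~c₂ → inj₁ (refl , c₁~c₂) , inj₂ r≡i) (consecutive-path c₁ c₂)

  path-to-hub : ∀ {i c} h → InCross i c h → Star (CrossStep i c) h (hub i c)
  path-to-hub (r , c′) (inj₁ refl) = column-path r _
  path-to-hub (r , c′) (inj₂ r≡i) = row-path r≡i c′ _ ◅◅ column-path r _

  cross-connected : ∀ i c → Connected (G Gχ) (cross i c)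
  cross-connected i c with y , y∈hub ← β-inhabited (hub i c) =
    connected-via-hub y (⋃⁺ (inCross? i c) (inj₁ refl) y∈hub) λ v v∈cross →
      let (h , h∈cross , v∈h) = ⋃⁻ (inCross? i c) v∈cross
      in ⋃-walk (inCross? i c) h∈cross (path-to-hub h h∈cross) v∈h y∈hub

  first-column : Fin M
  first-column = fromℕ< (*-mono-≤ q≥1 k≥1)

  cross-colorful : ∀ i c col → ∃ λ v → cross i c v ≡ true × χ Gχ v col ≡ true
  cross-colorful i c col =
    let (u , u∈h , u-has-col) = β-colors h col h-has-col
    in u , ⋃⁺ (inCross? i c) (inj₂ (remainder-combine j i)) u∈h , u-has-col
    where
      j = π ⟨$⟩ˡ col
      h = combine j i , first-column
      h-has-col : SegColor q k π h col ≡ true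
      h-has-col = segcolor-first-column q k π (combine j i) first-column col (toℕ-fromℕ< _)
                    (sym (trans (cong (π ⟨$⟩ʳ_) (quotient-combine j i)) (inverseʳ π)))

  crosses-meet : ∀ i c i′ c′ → ∃ λ v → cross i c v ≡ true × cross i′ c′ v ≡ true
  crosses-meet i c i′ c′ with v , v∈h ← β-inhabited (hub i′ c) =
    v , ⋃⁺ (inCross? i c) (inj₁ refl) v∈h , ⋃⁺ (inCross? i′ c′) (inj₂ (remainder-combine _ i′)) v∈h

  row-class : Cell → Fin k
  row-class (r , _) = remainder {q} k r

  cross⇒labelled : ∀ {i c v} → cross i c v ≡ true → Labelled proj₂ v c ⊎ Labelled row-class v i
  cross⇒labelled {i} {c} v∈cross with ⋃⁻ (inCross? i c) v∈cross
  ... | h , inj₁ c′≡c , v∈h = inj₁ (h , v∈h , c′≡c)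
  ... | h , inj₂ r≡i , v∈h = inj₂ (h , v∈h , r≡i)

  small-set-misses-a-cross : ∀ (Z : VSet (G Gχ)) → size Z < k →
                             ∃₂ λ i c → ∀ v → Z v ≡ true → cross i c v ≢ true
  small-set-misses-a-cross Z |Z|<k =
    let (i , class-i-missed) = few-vertices-miss-a-label Z |Z|<k (Labelled row-class)
                                 (labelled? row-class) (labelled-functional cell-≟ row-class)
        (c , column-c-missed) = few-vertices-miss-a-label Z (<-≤-trans |Z|<k k≤M) (Labelled proj₂)
                                 (labelled? proj₂) (labelled-functional cell-≟ proj₂)
        misses : ∀ v → Z v ≡ true → cross i c v ≢ true
        misses v v∈Z v∈cross = [ column-c-missed v v∈Z , class-i-missed v v∈Z ]′ (cross⇒labelled v∈cross)
    in i , c , misses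
    where
      cell-≟ : (h h′ : Cell) → Dec (h ≡ h′)
      cell-≟ = ≡-dec _≟ᶠ_ _≟ᶠ_
      k≤M : k ≤ M
      k≤M = subst (_≤ M) (*-identityˡ k) (*-monoˡ-≤ k q≥1)

lemma5p4 : ∀ (q k : ℕ) → 1 ≤ q → 1 ≤ k → (Gχ : ColorfulGraph q) →
    HasSegregatedGridMinor q k Gχ →
    ∀ (w : ℕ) → RtwAtMost Gχ w → k ∸ 1 ≤ w
lemma5p4 q k q≥1 k≥1 Gχ (π , minor) w (X , D , restricted) = ∸-monoˡ-≤ 1 (≮⇒≥ no-bag-smaller-than-k)
  where
    open SegregatedGrid q≥1 k≥1 π minor
    open TorsoDecomposition D
    open TreeDecomposition D using (T; bag; width)

    shadow : Fin k × Fin (q * k) → Fin (n (graph T)) → Bool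
    shadow (i , c) = nodes-meeting (cross i c)

    cross-meets-X : ∀ i c → ∃ λ x → cross i c x ≡ true × X x ≡ true
    cross-meets-X i c = colorful-set-meets Gχ restricted (cross-connected i c) (cross-colorful i c)

    bag-meeting-all-crosses : ∃ λ t → ∀ ic → shadow ic t ≡ true
    bag-meeting-all-crosses = helly T (×-searchable any? any?) shadow
      (λ (i , c) → nodes-meeting-connected (cross-connected i c) (cross-meets-X i c))
      (λ (i , c) (i′ , c′) → let (v , v∈cross , v∈cross′) = crosses-meet i c i′ c′ in
         nodes-meeting-intersect (cross-connected i c) (cross-connected i′ c′)
                                 (cross-meets-X i c) (cross-meets-X i′ c′) v v∈cross v∈cross′)

    no-bag-smaller-than-k : ¬ (suc w < k)
    no-bag-smaller-than-k w+1<k =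
      let (t , t-meets-all) = bag-meeting-all-crosses
          (i , c , bag-misses-cross) = small-set-misses-a-cross (bag t) (≤-<-trans (width t) w+1<k)
          (v , v∈t , v∈cross) = nodes-meeting⁻ (cross i c) (t-meets-all (i , c))
      in bag-misses-cross v v∈t v∈cross
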